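{- Let $n\ge 3$ be an even integer, let $\mathcal{F}$ be a 1-factorisation of $Circ(2n,\{1,2\})$, and let $Y\in\mathcal{F}$ be a 1-factor every edge of which is a 1-edge $e$ whose configuration $C_e$ is a 2-configuration. Then for every $X\in\mathcal{F}\setminus\{Y\}$, the union $X\cup Y$ is a Hamilton cycle of $Circ(2n,\{1,2\})$.
   Context: For a positive integer $N$ and $D\subseteq\{1,\dots,\lfloor N/2\rfloor\}$, the circulant graph $Circ(N,D)$ has vertex set $\mathbb{Z}_N$, with $u,v$ adjacent iff $u-v\equiv \pm d \pmod N$ for some $d\in D$. A 1-factor is a 1-regular spanning subgraph; a 1-factorisation is a partition of the edge set into 1-factors; regard a 1-factorisation as an edge colouring in which each 1-factor is a colour class. In $Circ(2n,\{1,2\})$ (arithmetic mod $2n$), a 1-edge is an edge $\{v,v+1\}$ and a 2-edge is an edge $\{v,v+2\}$. The configuration of the 1-edge $e=\{v,v+1\}$ is $C_e=\{\{v-1,v+1\},\{v,v+1\},\{v,v+2\}\}$; it is a $k$-configuration if exactly $k$ distinct colours (1-factors) occur on its three edges. -}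

module Defs where

open import Data.Nat using (ℕ; zero; suc; _+_; _*_; _∸_; NonZero)
open import Data.Nat.DivMod using (_%_; m%n<n)
open import Data.Fin using (Fin; toℕ; fromℕ<)
open import Data.Bool using (Bool; true; false)
open import Data.Product using (Σ; ∃; _×_; _,_; proj₁; proj₂)
open import Data.Sum using (_⊎_)
open import Relation.Binary.PropositionalEquality using (_≡_; _≢_)
open import Function.Definitions using (Injective)

-- Vertices of Circ(N,{1,2}) are Z_N, represented by Fin N.
-- v ⊕ k  is  v + k (mod N);  v ⊖ k  is  v - k (mod N) for k ≤ N.
module _ (N : ℕ) .{{_ : NonZero N}} where

  _⊕_ : Fin N → ℕ → Fin N
  v ⊕ k = fromℕ< (m%n<n (toℕ v + k) N)

  _⊖_ : Fin N → ℕ → Fin N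
  v ⊖ k = v ⊕ (N ∸ k)

-- An edge (v , false) is the 1-edge {v, v+1};
-- an edge (v , true)  is the 2-edge {v, v+2}.
-- For N ≥ 6 this is a bijective description of the edge set of Circ(N,{1,2}).
Edge : ℕ → Set
Edge N = Fin N × Bool

len : Bool → ℕ
len false = 1
len true  = 2

module _ {N : ℕ} .{{_ : NonZero N}} where

  end₂ : Edge N → Fin N
  end₂ (v , d) = _⊕_ N v (len d)

  Incident : Fin N → Edge N → Set
  Incident v e = proj₁ e ≡ v ⊎ end₂ e ≡ v

  Joins : Edge N → Fin N → Fin N → Set
  Joins e a b = (proj₁ e ≡ a × end₂ e ≡ b) ⊎ (proj₁ e ≡ b × end₂ e ≡ a)

  IsOneFactor : (Edge N → Set) → Set
  IsOneFactor S =
    ∀ v → (∃ λ e → S e × Incident v e)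
        × (∀ e e′ → S e → S e′ → Incident v e → Incident v e′ → e ≡ e′)

  -- a 1-factorisation as an edge colouring: every colour class is a 1-factor
  IsOneFactorisation : (Edge N → ℕ) → Set
  IsOneFactorisation col = ∀ e → IsOneFactor (λ e′ → col e′ ≡ col e)

  -- the configuration of the 1-edge {v,v+1} is
  -- { {v-1,v+1}, {v,v+1}, {v,v+2} } = { (v-1,true), (v,false), (v,true) };
  -- it is a 2-configuration iff exactly two distinct colours occur on it
  TwoConfiguration : (Edge N → ℕ) → Fin N → Set
  TwoConfiguration col v =
    let a = col (_⊖_ N v 1 , true)
        b = col (v , false)
        c = col (v , true)
    in (a ≡ b × b ≢ c) ⊎ (a ≡ c × a ≢ b) ⊎ (b ≡ c × a ≢ b)

  IsHamiltonCycle : (Edge N → Set) → Set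
  IsHamiltonCycle S =
    Σ (Fin N → Fin N) λ σ →
      Injective _≡_ _≡_ σ
      × (∀ e → (S e → ∃ λ i → Joins e (σ i) (σ (_⊕_ N i 1)))
             × ((∃ λ i → Joins e (σ i) (σ (_⊕_ N i 1))) → S e))

module Submission where

-- Y is a perfect matching of 1-edges, so its edges are {s + 2i, s + 2i + 1} for some s.
-- For a Y-edge {w, w+1} neither 2-edge of its configuration lies in Y, so the 2-configuration
-- condition says that {w-1, w+1} and {w, w+2} have the same colour.  Hence X contains exactly
-- one edge from the Y-edge {w, w+1} to the next one {w+2, w+3}: {w, w+2} if that is in X;
-- otherwise {w+1, w+3} if {w+2, w+4} is in X (the two share a colour); otherwise {w+1, w+2},
-- the only edge left at w+1.  Alternating between Y-edges and these X-edges runs through all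
-- n Y-edges in turn and closes up, a Hamilton cycle of X ∪ Y.

open import Defs
open import Data.Bool using (Bool; true; false; if_then_else_; T)
open import Data.Empty using (⊥-elim)
open import Data.Fin using (Fin; toℕ; fromℕ<)
open import Data.Fin.Properties using (toℕ-fromℕ<; toℕ-injective; toℕ<n)
open import Data.Nat using (ℕ; zero; suc; _+_; _*_; _∸_; _≤_; _<_; z≤n; s≤s; _<?_; _≟_; _≡ᵇ_; NonZero)
open import Data.Nat.Divisibility using (_∣_)
open import Data.Nat.DivMod using (_%_; m%n<n; %-distribˡ-+; m%n%n≡m%n; [m+n]%n≡m%n; m<n⇒m%n≡m; n%n≡0)
open import Data.Nat.Properties
  using (+-suc; +-comm; +-assoc; +-identityʳ; +-mono-≤; m+[n∸m]≡n; m∸n+n≡m; ≡ᵇ⇒≡; ≡⇒≡ᵇ;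
         ≤-refl; ≤-trans; ≤-antisym; <⇒≱; ≰⇒>; ≮⇒≥; n≤1+n; <-irrefl)
open import Data.Product using (∃; _×_; _,_; proj₁; proj₂)
open import Data.Sum using (_⊎_; inj₁; inj₂)
open import Data.Unit using (tt)
open import Function using (_∘_)
open import Function.Definitions using (Injective)
open import Relation.Binary.PropositionalEquality
  using (_≡_; _≢_; refl; sym; trans; cong; subst; module ≡-Reasoning)
open import Relation.Nullary using (yes; no)

data EvenOdd : ℕ → Set where
  even : ∀ i → EvenOdd (i + i)
  odd  : ∀ i → EvenOdd (suc (i + i))

evenOdd : ∀ m → EvenOdd m
evenOdd zero = even 0
evenOdd (suc m) with evenOdd m
... | even i = odd i
... | odd i  = subst EvenOdd (cong suc (+-suc i i)) (even (suc i))

interleave : {A : Set} → (ℕ → A) → (ℕ → A) → ℕ → A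
interleave f g zero          = f 0
interleave f g (suc zero)    = g 0
interleave f g (suc (suc m)) = interleave (f ∘ suc) (g ∘ suc) m

interleave-even : {A : Set} (f g : ℕ → A) → ∀ i → interleave f g (i + i) ≡ f i
interleave-even f g zero    = refl
interleave-even f g (suc i) rewrite +-suc i i = interleave-even (f ∘ suc) (g ∘ suc) i

interleave-odd : {A : Set} (f g : ℕ → A) → ∀ i → interleave f g (suc (i + i)) ≡ g i
interleave-odd f g zero    = refl
interleave-odd f g (suc i) rewrite +-suc i i = interleave-odd (f ∘ suc) (g ∘ suc) i

swapPairs : (ℕ → Bool) → ℕ → ℕ
swapPairs β = interleave (λ i → if β i then suc (i + i) else i + i)
                         (λ i → if β i then i + i else suc (i + i))

swapPairs-even : ∀ β i → swapPairs β (i + i) ≡ (if β i then suc (i + i) else i + i)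
swapPairs-even β = interleave-even _ _

swapPairs-odd : ∀ β i → swapPairs β (suc (i + i)) ≡ (if β i then i + i else suc (i + i))
swapPairs-odd β = interleave-odd _ _

swapPairs-involutive : ∀ β m → swapPairs β (swapPairs β m) ≡ m
swapPairs-involutive β m with evenOdd m
... | even i with β i | swapPairs-even β i | swapPairs-odd β i
...   | true  | e | o = trans (cong (swapPairs β) e) o
...   | false | e | _ = trans (cong (swapPairs β) e) e
swapPairs-involutive β m | odd i with β i | swapPairs-even β i | swapPairs-odd β i
...   | true  | e | o = trans (cong (swapPairs β) o) e
...   | false | _ | o = trans (cong (swapPairs β) o) o

suc-even< : ∀ {i n} → i + i < n + n → suc (i + i) < n + n
suc-even< {i} {n} p = subst (_≤ n + n) (cong suc (+-suc i i)) (+-mono-≤ i<n i<n)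
  where
  i<n : i < n
  i<n = ≰⇒> (λ n≤i → <⇒≱ p (+-mono-≤ n≤i n≤i))

swapPairs-< : ∀ β {n m} → m < n + n → swapPairs β m < n + n
swapPairs-< β {n} {m} p with evenOdd m
... | even i = subst (_< n + n) (sym (swapPairs-even β i)) (bound (β i))
  where
  bound : ∀ b → (if b then suc (i + i) else i + i) < n + n
  bound true  = suc-even< {i} {n} p
  bound false = p
... | odd i = subst (_< n + n) (sym (swapPairs-odd β i)) (bound (β i))
  where
  bound : ∀ b → (if b then i + i else suc (i + i)) < n + n
  bound true  = ≤-trans (n≤1+n _) p
  bound false = p

module Residue (N : ℕ) .{{_ : NonZero N}} where

  infixl 6 _⊕′_ _⊖′_

  _⊕′_ _⊖′_ : Fin N → ℕ → Fin N
  _⊕′_ = _⊕_ N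
  _⊖′_ = _⊖_ N

  ⟦_⟧ : ℕ → Fin N
  ⟦ a ⟧ = fromℕ< (m%n<n a N)

  toℕ-⟦⟧ : ∀ a → toℕ ⟦ a ⟧ ≡ a % N
  toℕ-⟦⟧ a = toℕ-fromℕ< (m%n<n a N)

  ⟦⟧-cong : ∀ {a b} → a % N ≡ b % N → ⟦ a ⟧ ≡ ⟦ b ⟧
  ⟦⟧-cong {a} {b} eq = toℕ-injective (trans (toℕ-⟦⟧ a) (trans eq (sym (toℕ-⟦⟧ b))))

  ⟦⟧-injective : ∀ {a b} → a < N → b < N → ⟦ a ⟧ ≡ ⟦ b ⟧ → a ≡ b
  ⟦⟧-injective {a} {b} a<N b<N eq = begin
    a               ≡⟨ sym (m<n⇒m%n≡m a<N) ⟩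
    a % N           ≡⟨ sym (toℕ-⟦⟧ a) ⟩
    toℕ ⟦ a ⟧       ≡⟨ cong toℕ eq ⟩
    toℕ ⟦ b ⟧       ≡⟨ toℕ-⟦⟧ b ⟩
    b % N           ≡⟨ m<n⇒m%n≡m b<N ⟩
    b               ∎
    where open ≡-Reasoning

  ⟦toℕ⟧ : ∀ u → ⟦ toℕ u ⟧ ≡ u
  ⟦toℕ⟧ u = toℕ-injective (trans (toℕ-⟦⟧ (toℕ u)) (m<n⇒m%n≡m (toℕ<n u)))

  ⟦+N⟧ : ∀ a → ⟦ a + N ⟧ ≡ ⟦ a ⟧
  ⟦+N⟧ a = ⟦⟧-cong ([m+n]%n≡m%n a N)

  ⟦⟧-⊕ : ∀ a k → ⟦ a ⟧ ⊕′ k ≡ ⟦ a + k ⟧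
  ⟦⟧-⊕ a k = ⟦⟧-cong (begin
    (toℕ ⟦ a ⟧ + k) % N            ≡⟨ cong (λ r → (r + k) % N) (toℕ-⟦⟧ a) ⟩
    (a % N + k) % N                ≡⟨ %-distribˡ-+ (a % N) k N ⟩
    (a % N % N + k % N) % N        ≡⟨ cong (λ r → (r + k % N) % N) (m%n%n≡m%n a N) ⟩
    (a % N + k % N) % N            ≡⟨ sym (%-distribˡ-+ a k N) ⟩
    (a + k) % N                    ∎)
    where open ≡-Reasoning

  ⟦⟧-⊖ : ∀ a {k} → k ≤ N → ⟦ a + k ⟧ ⊖′ k ≡ ⟦ a ⟧
  ⟦⟧-⊖ a {k} k≤N = begin
    ⟦ a + k ⟧ ⊖′ k            ≡⟨ ⟦⟧-⊕ (a + k) (N ∸ k) ⟩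
    ⟦ a + k + (N ∸ k) ⟧       ≡⟨ cong ⟦_⟧ (+-assoc a k (N ∸ k)) ⟩
    ⟦ a + (k + (N ∸ k)) ⟧     ≡⟨ cong (λ m → ⟦ a + m ⟧) (m+[n∸m]≡n k≤N) ⟩
    ⟦ a + N ⟧                 ≡⟨ ⟦+N⟧ a ⟩
    ⟦ a ⟧                     ∎
    where open ≡-Reasoning

  ⊕-⊖ : ∀ u {k} → k ≤ N → u ⊕′ k ⊖′ k ≡ u
  ⊕-⊖ u k≤N = trans (⟦⟧-⊖ (toℕ u) k≤N) (⟦toℕ⟧ u)

  ⊖-⊕ : ∀ u {k} → k ≤ N → u ⊖′ k ⊕′ k ≡ u
  ⊖-⊕ u {k} k≤N = begin
    u ⊖′ k ⊕′ k                 ≡⟨ ⟦⟧-⊕ (toℕ u + (N ∸ k)) k ⟩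
    ⟦ toℕ u + (N ∸ k) + k ⟧     ≡⟨ cong ⟦_⟧ (+-assoc (toℕ u) (N ∸ k) k) ⟩
    ⟦ toℕ u + (N ∸ k + k) ⟧     ≡⟨ cong (λ m → ⟦ toℕ u + m ⟧) (m∸n+n≡m k≤N) ⟩
    ⟦ toℕ u + N ⟧               ≡⟨ ⟦+N⟧ (toℕ u) ⟩
    ⟦ toℕ u ⟧                   ≡⟨ ⟦toℕ⟧ u ⟩
    u                           ∎
    where open ≡-Reasoning

  ⊕-⊕ : ∀ u a b → u ⊕′ a ⊕′ b ≡ u ⊕′ (a + b)
  ⊕-⊕ u a b = trans (⟦⟧-⊕ (toℕ u + a) b) (cong ⟦_⟧ (+-assoc (toℕ u) a b))

  ⊕-≢ : ∀ u {k} → 0 < k → k < N → u ⊕′ k ≢ u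
  ⊕-≢ u {k} 0<k k<N eq = <-irrefl (sym k≡0) 0<k
    where
    t = toℕ u
    t≤N = ≤-trans (n≤1+n t) (toℕ<n u)
    open ≡-Reasoning
    k≡0 : k ≡ 0
    k≡0 = ⟦⟧-injective k<N (≤-trans (s≤s z≤n) k<N) (begin
      ⟦ k ⟧               ≡⟨ sym (⟦⟧-⊖ k t≤N) ⟩
      ⟦ k + t ⟧ ⊖′ t      ≡⟨ cong (λ m → ⟦ m ⟧ ⊖′ t) (+-comm k t) ⟩
      u ⊕′ k ⊖′ t         ≡⟨ cong (_⊖′ t) eq ⟩
      u ⊖′ t              ≡⟨ cong (_⊖′ t) (sym (⟦toℕ⟧ u)) ⟩
      ⟦ 0 + t ⟧ ⊖′ t      ≡⟨ ⟦⟧-⊖ 0 t≤N ⟩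
      ⟦ 0 ⟧               ∎)

  ⊕-⊕-⊖ : ∀ u a {b} → b ≤ N → u ⊕′ (a + b) ⊖′ b ≡ u ⊕′ a
  ⊕-⊕-⊖ u a {b} b≤N = trans (cong (_⊖′ b) (sym (⊕-⊕ u a b))) (⊕-⊖ (u ⊕′ a) b≤N)

  ⊕-⊖-+ : ∀ u a {b} → b ≤ N → b + a ≤ N → u ⊕′ a ⊖′ (b + a) ≡ u ⊖′ b
  ⊕-⊖-+ u a {b} b≤N b+a≤N = begin
    u ⊕′ a ⊖′ (b + a)              ≡⟨ cong (λ w → w ⊕′ a ⊖′ (b + a)) (sym (⊖-⊕ u b≤N)) ⟩
    u ⊖′ b ⊕′ b ⊕′ a ⊖′ (b + a)    ≡⟨ cong (_⊖′ (b + a)) (⊕-⊕ (u ⊖′ b) b a) ⟩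
    u ⊖′ b ⊕′ (b + a) ⊖′ (b + a)   ≡⟨ ⊕-⊖ (u ⊖′ b) b+a≤N ⟩
    u ⊖′ b                         ∎
    where open ≡-Reasoning

  ⊕1-periodic : {A : Set} (f : ℕ → A) → f N ≡ f 0 → ∀ k → f (toℕ (k ⊕′ 1)) ≡ f (suc (toℕ k))
  ⊕1-periodic f fN≡f0 k with suc (toℕ k) <? N
  ... | yes k+1<N = cong f (trans (toℕ-⟦⟧ (toℕ k + 1))
                             (trans (cong (_% N) (+-comm (toℕ k) 1)) (m<n⇒m%n≡m k+1<N)))
  ... | no k+1≮N = trans (cong f wraps) (trans (sym fN≡f0) (cong f (sym k+1≡N)))
    where
    k+1≡N : suc (toℕ k) ≡ N
    k+1≡N = ≤-antisym (toℕ<n k) (≮⇒≥ k+1≮N)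
    wraps : toℕ (k ⊕′ 1) ≡ 0
    wraps = trans (toℕ-⟦⟧ (toℕ k + 1))
              (trans (cong (_% N) (trans (+-comm (toℕ k) 1) k+1≡N)) (n%n≡0 N))

  module Relabel {π : ℕ → ℕ} (π-involutive : ∀ m → π (π m) ≡ m) (π-< : ∀ {m} → m < N → π m < N)
                 {s : ℕ} (s≤N : s ≤ N) where

    relabel : Fin N → Fin N
    relabel k = ⟦ π (toℕ k) + s ⟧

    relabel-injective : Injective _≡_ _≡_ relabel
    relabel-injective {k} {k′} eq = toℕ-injective (begin
      toℕ k                 ≡⟨ sym (π-involutive (toℕ k)) ⟩
      π (π (toℕ k))         ≡⟨ cong π πk≡πk′ ⟩
      π (π (toℕ k′))        ≡⟨ π-involutive (toℕ k′) ⟩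
      toℕ k′                ∎)
      where
      open ≡-Reasoning
      πk≡πk′ : π (toℕ k) ≡ π (toℕ k′)
      πk≡πk′ = ⟦⟧-injective (π-< (toℕ<n k)) (π-< (toℕ<n k′))
                 (trans (sym (⟦⟧-⊖ _ s≤N)) (trans (cong (_⊖′ s) eq) (⟦⟧-⊖ _ s≤N)))

    relabel-surjective : ∀ w → ∃ λ k → relabel k ≡ w
    relabel-surjective w = fromℕ< πa<N , (begin
      ⟦ π (toℕ (fromℕ< πa<N)) + s ⟧   ≡⟨ cong (λ m → ⟦ π m + s ⟧) (toℕ-fromℕ< πa<N) ⟩
      ⟦ π (π a) + s ⟧                 ≡⟨ cong (λ m → ⟦ m + s ⟧) (π-involutive a) ⟩
      ⟦ a + s ⟧                       ≡⟨ sym (⟦⟧-⊕ a s) ⟩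
      ⟦ a ⟧ ⊕′ s                      ≡⟨ cong (_⊕′ s) (⟦toℕ⟧ (w ⊖′ s)) ⟩
      w ⊖′ s ⊕′ s                     ≡⟨ ⊖-⊕ w s≤N ⟩
      w                               ∎)
      where
      open ≡-Reasoning
      a = toℕ (w ⊖′ s)
      πa<N = π-< (toℕ<n (w ⊖′ s))

module EdgeGeometry {N : ℕ} .{{_ : NonZero N}} where
  open Residue N

  data Around (w : Fin N) : Edge N → Set where
    right₁ : Around w (w , false)
    right₂ : Around w (w , true)
    left₁  : Around w (w ⊖′ 1 , false)
    left₂  : Around w (w ⊖′ 2 , true)

  len≤2 : ∀ d → len d ≤ 2
  len≤2 false = s≤s z≤n
  len≤2 true  = ≤-refl

  incident⇒around : 2 ≤ N → ∀ {w e} → Incident w e → Around w e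
  incident⇒around _ {e = u , false} (inj₁ refl) = right₁
  incident⇒around _ {e = u , true}  (inj₁ refl) = right₂
  incident⇒around 2≤N {w} {u , d} (inj₂ end≡w) = subst (λ v → Around w (v , d)) (sym u≡) (left d)
    where
    u≡ : u ≡ w ⊖′ len d
    u≡ = trans (sym (⊕-⊖ u (≤-trans (len≤2 d) 2≤N))) (cong (_⊖′ len d) end≡w)
    left : ∀ d → Around w (w ⊖′ len d , d)
    left false = left₁
    left true  = left₂

  joins-incidentˡ : ∀ {e a b} → Joins e a b → Incident a e
  joins-incidentˡ (inj₁ (p , _)) = inj₁ p
  joins-incidentˡ (inj₂ (_ , q)) = inj₂ q

  joins-incidentʳ : ∀ {e a b} → Joins e a b → Incident b e
  joins-incidentʳ (inj₁ (_ , q)) = inj₂ q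
  joins-incidentʳ (inj₂ (p , _)) = inj₁ p

  ⊕-len-injective : 2 < N → ∀ u d d′ → u ⊕′ len d ≡ u ⊕′ len d′ → d ≡ d′
  ⊕-len-injective _   u false false _  = refl
  ⊕-len-injective _   u true  true  _  = refl
  ⊕-len-injective 2<N u false true  eq = ⊥-elim (⊕-≢ (u ⊕′ 1) (s≤s z≤n) (≤-trans (n≤1+n 2) 2<N)
                                                   (trans (⊕-⊕ u 1 1) (sym eq)))
  ⊕-len-injective 2<N u true  false eq = ⊥-elim (⊕-≢ (u ⊕′ 1) (s≤s z≤n) (≤-trans (n≤1+n 2) 2<N)
                                                   (trans (⊕-⊕ u 1 1) eq))

  ⊕-len-len-≢ : 4 < N → ∀ u d d′ → u ⊕′ len d ⊕′ len d′ ≢ u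
  ⊕-len-len-≢ 4<N u d d′ eq =
    ⊕-≢ u (positive d) (≤-trans (s≤s (+-mono-≤ (len≤2 d) (len≤2 d′))) 4<N) (trans (sym (⊕-⊕ u _ _)) eq)
    where
    positive : ∀ d → 0 < len d + len d′
    positive false = s≤s z≤n
    positive true  = s≤s z≤n

  joins-unique : 4 < N → ∀ {e e′ a b} → Joins e a b → Joins e′ a b → e ≡ e′
  joins-unique 4<N {u , d} {_ , d′} (inj₁ (refl , refl)) (inj₁ (refl , eq)) =
    cong (u ,_) (⊕-len-injective (≤-trans (s≤s (s≤s (s≤s z≤n))) 4<N) u d d′ (sym eq))
  joins-unique 4<N {u , d} {_ , d′} (inj₂ (refl , refl)) (inj₂ (refl , eq)) =
    cong (u ,_) (⊕-len-injective (≤-trans (s≤s (s≤s (s≤s z≤n))) 4<N) u d d′ (sym eq))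
  joins-unique 4<N {u , d} {_ , d′} (inj₁ (refl , refl)) (inj₂ (refl , eq)) = ⊥-elim (⊕-len-len-≢ 4<N u d d′ eq)
  joins-unique 4<N {u , d} {_ , d′} (inj₂ (refl , refl)) (inj₁ (refl , eq)) = ⊥-elim (⊕-len-len-≢ 4<N u d d′ eq)

module OneFactorisation {N : ℕ} .{{_ : NonZero N}} {col : Edge N → ℕ} (fac : IsOneFactorisation col) where
  open Residue N
  open EdgeGeometry

  colour-unique : ∀ {w e e′} → col e ≡ col e′ → Incident w e → Incident w e′ → e ≡ e′
  colour-unique {w} {e} {e′} same i i′ = proj₂ (fac e w) e e′ refl (sym same) i i′

  colour-at : ∀ {c} → (∃ λ e → col e ≡ c) → ∀ w → ∃ λ e → col e ≡ c × Incident w e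
  colour-at (e , refl) w = proj₁ (fac e w)

  module _ {x y : ℕ} where

    Coloured : ℕ → Set
    Coloured c = c ≡ x ⊎ c ≡ y

    coloured-≢⇒≡ : ∀ {a b c} → Coloured a → Coloured b → Coloured c → a ≢ c → b ≢ c → a ≡ b
    coloured-≢⇒≡ (inj₁ refl) (inj₁ refl) _           _   _   = refl
    coloured-≢⇒≡ (inj₂ refl) (inj₂ refl) _           _   _   = refl
    coloured-≢⇒≡ (inj₁ refl) (inj₂ refl) (inj₁ refl) a≢c _   = ⊥-elim (a≢c refl)
    coloured-≢⇒≡ (inj₁ refl) (inj₂ refl) (inj₂ refl) _   b≢c = ⊥-elim (b≢c refl)
    coloured-≢⇒≡ (inj₂ refl) (inj₁ refl) (inj₁ refl) _   b≢c = ⊥-elim (b≢c refl)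
    coloured-≢⇒≡ (inj₂ refl) (inj₁ refl) (inj₂ refl) a≢c _   = ⊥-elim (a≢c refl)

    -- At σ k the walk has two edges, E (k ⊖ 1) and E k, of the two different colours,
    -- so the edge of colour x and the edge of colour y at σ k are both on the walk.
    alternatingCycle⇒hamiltonCycle : 4 < N →
      (σ : Fin N → Fin N) → Injective _≡_ _≡_ σ → (∀ w → ∃ λ k → σ k ≡ w) →
      (E : Fin N → Edge N) → (∀ k → Joins (E k) (σ k) (σ (k ⊕′ 1))) →
      (∀ k → Coloured (col (E k))) → (∀ k → col (E k) ≢ col (E (k ⊕′ 1))) →
      IsHamiltonCycle (λ e → Coloured (col e))
    alternatingCycle⇒hamiltonCycle 4<N σ σ-injective σ-surjective E E-joins E-coloured E-alternates =
      σ , σ-injective , λ e → on-walk e , walk-coloured e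
      where
      on-walk : ∀ e → Coloured (col e) → ∃ λ k → Joins e (σ k) (σ (k ⊕′ 1))
      on-walk e e-coloured with σ-surjective (proj₁ e)
      ... | k , σk≡ with col e ≟ col (E k)
      ...   | yes same = k , subst (λ f → Joins f (σ k) (σ (k ⊕′ 1))) (sym e≡Ek) (E-joins k)
        where
        e≡Ek : e ≡ E k
        e≡Ek = colour-unique same (inj₁ (sym σk≡)) (joins-incidentˡ (E-joins k))
      ...   | no differ = j , subst (λ f → Joins f (σ j) (σ (j ⊕′ 1))) (sym e≡Ej) (E-joins j)
        where
        j = k ⊖′ 1
        j⊕1≡k : j ⊕′ 1 ≡ k
        j⊕1≡k = ⊖-⊕ k (≤-trans (s≤s z≤n) 4<N)
        same : col e ≡ col (E j)
        same = coloured-≢⇒≡ e-coloured (E-coloured j) (E-coloured k) differ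
                 (subst (λ i → col (E j) ≢ col (E i)) j⊕1≡k (E-alternates j))
        e≡Ej : e ≡ E j
        e≡Ej = colour-unique same (inj₁ (sym σk≡))
                 (subst (λ i → Incident (σ i) (E j)) j⊕1≡k (joins-incidentʳ (E-joins j)))

      walk-coloured : ∀ e → (∃ λ k → Joins e (σ k) (σ (k ⊕′ 1))) → Coloured (col e)
      walk-coloured e (k , e-joins) = subst (Coloured ∘ col) (joins-unique 4<N (E-joins k) e-joins) (E-coloured k)

module TwoConfigurationFactor (n : ℕ) (3≤n : 3 ≤ n) .{{_ : NonZero (2 * n)}}
  (col : Edge (2 * n) → ℕ) (fac : IsOneFactorisation col)
  (y : ℕ) (ey : ∃ λ e → col e ≡ y)
  (hy : ∀ e → col e ≡ y → (proj₂ e ≡ false) × TwoConfiguration col (proj₁ e))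
  (x : ℕ) (ex : ∃ λ e → col e ≡ x) (x≢y : x ≢ y) where

  N : ℕ
  N = 2 * n

  open Residue N
  open EdgeGeometry
  open OneFactorisation fac

  N≡n+n : N ≡ n + n
  N≡n+n = cong (n +_) (+-identityʳ n)

  4<N : 4 < N
  4<N = subst (4 <_) (sym N≡n+n) (≤-trans (n≤1+n 5) (+-mono-≤ 3≤n 3≤n))

  1≤N : 1 ≤ N
  1≤N = ≤-trans (s≤s z≤n) 4<N

  2≤N : 2 ≤ N
  2≤N = ≤-trans (s≤s (s≤s z≤n)) 4<N

  1<N : 1 < N
  1<N = 2≤N

  two-edge-not-y : ∀ {u} → col (u , true) ≢ y
  two-edge-not-y c with proj₁ (hy _ c)
  ... | ()

  y-config : ∀ w → col (w , false) ≡ y → col (w ⊖′ 1 , true) ≡ col (w , true)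
  y-config w c with proj₂ (hy (w , false) c)
  ... | inj₁ (a≡b , _)        = ⊥-elim (two-edge-not-y (trans a≡b c))
  ... | inj₂ (inj₁ (a≡c , _)) = a≡c
  ... | inj₂ (inj₂ (b≡c , _)) = ⊥-elim (two-edge-not-y (trans (sym b≡c) c))

  y-propagates : ∀ w → col (w , false) ≡ y → col (w ⊕′ 2 , false) ≡ y
  y-propagates w c with colour-at ey (w ⊕′ 2)
  ... | e , c′ , inc with incident⇒around 2≤N inc
  ...   | right₁ = c′
  ...   | right₂ = ⊥-elim (two-edge-not-y c′)
  ...   | left₂  = ⊥-elim (two-edge-not-y c′)
  ...   | left₁  = ⊥-elim (⊕-≢ w (s≤s z≤n) 1<N (sym (cong proj₁ same)))
    where
    c″ : col (w ⊕′ 1 , false) ≡ y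
    c″ = subst (λ v → col (v , false) ≡ y) (⊕-⊕-⊖ w 1 1≤N) c′
    same : (w , false) ≡ (w ⊕′ 1 , false)
    same = colour-unique (trans c (sym c″)) (inj₂ refl) (inj₁ refl)

  start : Fin N
  start = proj₁ (proj₁ ey)

  s : ℕ
  s = toℕ start

  s≤N : s ≤ N
  s≤N = ≤-trans (n≤1+n s) (toℕ<n start)

  corner : ℕ → Fin N
  corner i = ⟦ i + i + s ⟧

  corner-suc : ∀ i → corner (suc i) ≡ corner i ⊕′ 2
  corner-suc i = trans (cong (λ m → ⟦ suc m + s ⟧) (+-suc i i))
                   (sym (trans (⟦⟧-⊕ (i + i + s) 2) (cong ⟦_⟧ (+-comm (i + i + s) 2))))

  corner-periodic : corner n ≡ corner 0
  corner-periodic = trans (cong ⟦_⟧ (trans (+-comm (n + n) s) (cong (s +_) (sym N≡n+n)))) (⟦+N⟧ s)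

  start-y : col (start , false) ≡ y
  start-y = subst (λ d → col (start , d) ≡ y) (proj₁ (hy (proj₁ ey) (proj₂ ey))) (proj₂ ey)

  y-corners : ∀ i → col (corner i , false) ≡ y
  y-corners zero    = subst (λ w → col (w , false) ≡ y) (sym (⟦toℕ⟧ start)) start-y
  y-corners (suc i) = subst (λ w → col (w , false) ≡ y) (sym (corner-suc i)) (y-propagates _ (y-corners i))

  two-edge-colour-shift : ∀ i → col (corner i ⊕′ 1 , true) ≡ col (corner (suc i) , true)
  two-edge-colour-shift i = trans (cong (λ w → col (w , true)) (sym prev≡)) (y-config _ (y-corners (suc i)))
    where
    prev≡ : corner (suc i) ⊖′ 1 ≡ corner i ⊕′ 1
    prev≡ = trans (cong (_⊖′ 1) (corner-suc i)) (⊕-⊕-⊖ (corner i) 1 1≤N)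

  x₂-at : Fin N → Bool
  x₂-at w = col (w , true) ≡ᵇ x

  x₂-at-true : ∀ {w} → x₂-at w ≡ true → col (w , true) ≡ x
  x₂-at-true eq = ≡ᵇ⇒≡ _ _ (subst T (sym eq) tt)

  x₂-at-false : ∀ {w} → x₂-at w ≡ false → col (w , true) ≢ x
  x₂-at-false eq c = subst T eq (≡⇒≡ᵇ _ _ c)

  β : ℕ → Bool
  β i = x₂-at (corner i)

  not-both : ∀ i → β i ≡ true → β (suc i) ≡ false
  not-both i βi with β (suc i) in βi+1
  ... | false = refl
  ... | true  = ⊥-elim (⊕-≢ (corner i) (s≤s z≤n) 2<N
                   (trans (sym (corner-suc i)) (sym (cong proj₁ same))))
    where
    2<N : 2 < N
    2<N = ≤-trans (s≤s (s≤s (s≤s z≤n))) 4<N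
    same : (corner i , true) ≡ (corner (suc i) , true)
    same = colour-unique (trans (x₂-at-true βi) (sym (x₂-at-true βi+1)))
             (inj₂ (sym (corner-suc i))) (inj₁ refl)

  entry exit : Bool → Fin N → Fin N
  entry b w = if b then w ⊕′ 1 else w
  exit  b w = if b then w else w ⊕′ 1

  -- The X-edge leaving the Y-edge at corner w towards the next one, given which of
  -- the 2-edges starting at w and at w ⊕ 2 belong to X.
  link : Bool → Bool → Fin N → Edge N
  link true  _     w = (w , true)
  link false true  w = (w ⊕′ 1 , true)
  link false false w = (w ⊕′ 1 , false)

  block-joins : ∀ b w → Joins (w , false) (entry b w) (exit b w)
  block-joins true  w = inj₂ (refl , refl)
  block-joins false w = inj₁ (refl , refl)

  link-joins : ∀ b b′ w → (b ≡ true → b′ ≡ false) → Joins (link b b′ w) (exit b w) (entry b′ (w ⊕′ 2))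
  link-joins true  true  w not-both with not-both refl
  ... | ()
  link-joins true  false w _ = inj₁ (refl , refl)
  link-joins false true  w _ = inj₁ (refl , trans (⊕-⊕ w 1 2) (sym (⊕-⊕ w 2 1)))
  link-joins false false w _ = inj₁ (refl , ⊕-⊕ w 1 1)

  lone-link : ∀ i → β i ≡ false → β (suc i) ≡ false → col (corner i ⊕′ 1 , false) ≡ x
  lone-link i βi βi+1 with colour-at ex (corner i ⊕′ 1)
  ... | e , c , inc with incident⇒around 2≤N inc
  ...   | right₁ = c
  ...   | right₂ = ⊥-elim (x₂-at-false βi+1 (trans (sym (two-edge-colour-shift i)) c))
  ...   | left₁  = ⊥-elim (x≢y (trans (sym c) (trans (cong (λ w → col (w , false)) (⊕-⊖ (corner i) 1≤N))
                                                  (y-corners i))))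
  ...   | left₂  = ⊥-elim (x₂-at-false βi (trans (sym (y-config _ (y-corners i)))
                     (trans (cong (λ w → col (w , true)) (sym (⊕-⊖-+ (corner i) 1 1≤N 2≤N))) c)))

  link-colour : ∀ i → col (link (β i) (β (suc i)) (corner i)) ≡ x
  link-colour i with β i in βi | β (suc i) in βi+1
  ... | true  | _     = x₂-at-true βi
  ... | false | true  = trans (two-edge-colour-shift i) (x₂-at-true βi+1)
  ... | false | false = lone-link i βi βi+1

  -- The Hamilton cycle, read from corner 0: position 2i is where it enters the i-th Y-edge,
  -- position 2i + 1 where it leaves it along an X-edge.
  walk : ℕ → Fin N
  walk m = ⟦ swapPairs β m + s ⟧

  trail : ℕ → Edge N
  trail = interleave (λ i → (corner i , false)) (λ i → link (β i) (β (suc i)) (corner i))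

  walk-even : ∀ i → walk (i + i) ≡ entry (β i) (corner i)
  walk-even i = trans (cong (λ m → ⟦ m + s ⟧) (swapPairs-even β i)) (vertex (β i))
    where
    vertex : ∀ b → ⟦ (if b then suc (i + i) else i + i) + s ⟧ ≡ entry b (corner i)
    vertex true  = sym (trans (⟦⟧-⊕ (i + i + s) 1) (cong ⟦_⟧ (+-comm (i + i + s) 1)))
    vertex false = refl

  walk-odd : ∀ i → walk (suc (i + i)) ≡ exit (β i) (corner i)
  walk-odd i = trans (cong (λ m → ⟦ m + s ⟧) (swapPairs-odd β i)) (vertex (β i))
    where
    vertex : ∀ b → ⟦ (if b then i + i else suc (i + i)) + s ⟧ ≡ exit b (corner i)
    vertex true  = refl
    vertex false = sym (trans (⟦⟧-⊕ (i + i + s) 1) (cong ⟦_⟧ (+-comm (i + i + s) 1)))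

  walk-next-even : ∀ i → walk (suc (suc (i + i))) ≡ entry (β (suc i)) (corner i ⊕′ 2)
  walk-next-even i = trans (cong (λ m → walk (suc m)) (sym (+-suc i i)))
                       (trans (walk-even (suc i)) (cong (entry (β (suc i))) (corner-suc i)))

  trail-even : ∀ i → trail (i + i) ≡ (corner i , false)
  trail-even = interleave-even _ _

  trail-odd : ∀ i → trail (suc (i + i)) ≡ link (β i) (β (suc i)) (corner i)
  trail-odd = interleave-odd _ _

  trail-next-even : ∀ i → trail (suc (suc (i + i))) ≡ (corner (suc i) , false)
  trail-next-even i = trans (cong (λ m → trail (suc m)) (sym (+-suc i i))) (trail-even (suc i))

  trail-joins : ∀ m → Joins (trail m) (walk m) (walk (suc m))
  trail-joins m with evenOdd m
  ... | even i rewrite trail-even i | walk-even i | walk-odd i = block-joins (β i) (corner i)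
  ... | odd i rewrite trail-odd i | walk-odd i | walk-next-even i =
    link-joins (β i) (β (suc i)) (corner i) (not-both i)

  trail-coloured : ∀ m → Coloured {x} {y} (col (trail m))
  trail-coloured m with evenOdd m
  ... | even i = inj₂ (trans (cong col (trail-even i)) (y-corners i))
  ... | odd i  = inj₁ (trans (cong col (trail-odd i)) (link-colour i))

  trail-alternates : ∀ m → col (trail m) ≢ col (trail (suc m))
  trail-alternates m with evenOdd m
  ... | even i = λ eq → x≢y (trans (sym odd-x) (trans (sym eq) even-y))
    where
    even-y = trans (cong col (trail-even i)) (y-corners i)
    odd-x  = trans (cong col (trail-odd i)) (link-colour i)
  ... | odd i = λ eq → x≢y (trans (sym odd-x) (trans eq even-y))
    where
    even-y = trans (cong col (trail-next-even i)) (y-corners (suc i))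
    odd-x  = trans (cong col (trail-odd i)) (link-colour i)

  walk-periodic : walk N ≡ walk 0
  walk-periodic = begin
    walk N                     ≡⟨ cong walk N≡n+n ⟩
    walk (n + n)               ≡⟨ walk-even n ⟩
    entry (β n) (corner n)     ≡⟨ cong (λ w → entry (x₂-at w) w) corner-periodic ⟩
    entry (β 0) (corner 0)     ≡⟨ sym (walk-even 0) ⟩
    walk 0                     ∎
    where open ≡-Reasoning

  trail-periodic : trail N ≡ trail 0
  trail-periodic = trans (cong trail N≡n+n) (trans (trail-even n) (cong (_, false) corner-periodic))

  swapPairs-<N : ∀ {m} → m < N → swapPairs β m < N
  swapPairs-<N {m} m<N = subst (swapPairs β m <_) (sym N≡n+n) (swapPairs-< β {n} (subst (m <_) N≡n+n m<N))

  open Relabel (swapPairs-involutive β) swapPairs-<N s≤N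

  hamiltonian : IsHamiltonCycle (λ e → col e ≡ x ⊎ col e ≡ y)
  hamiltonian = alternatingCycle⇒hamiltonCycle 4<N relabel relabel-injective relabel-surjective
    (trail ∘ toℕ)
    (λ k → subst (Joins (trail (toℕ k)) (relabel k)) (sym (⊕1-periodic walk walk-periodic k))
             (trail-joins (toℕ k)))
    (trail-coloured ∘ toℕ)
    (λ k → subst (λ e → col (trail (toℕ k)) ≢ col e) (sym (⊕1-periodic trail trail-periodic k))
             (trail-alternates (toℕ k)))

mainTheorem18 : (n : ℕ) → 3 ≤ n → 2 ∣ n → .{{_ : NonZero (2 * n)}} →
    (col : Edge (2 * n) → ℕ) → IsOneFactorisation col →
    (y : ℕ) → (∃ λ e → col e ≡ y) →
    (∀ e → col e ≡ y → (proj₂ e ≡ false) × TwoConfiguration col (proj₁ e)) →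
    (x : ℕ) → (∃ λ e → col e ≡ x) → x ≢ y →
    IsHamiltonCycle (λ e → col e ≡ x ⊎ col e ≡ y)
mainTheorem18 n 3≤n _ col fac y ey hy x ex x≢y =
  TwoConfigurationFactor.hamiltonian n 3≤n col fac y ey hy x ex x≢y
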